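{- Let $L/K$ be a finite Galois extension of fields with group $G$, and $F/K$ a subextension such that $G_F = \mathrm{Gal}(L/F)$ has a normal complement $C$ in $G$. Suppose there are Hopf–Galois structures on $F/K$ and $L/F$ with underlying groups $S$ and $T$ respectively, and let $N = S\times T$ be the underlying group of the Hopf–Galois structure on $L/K$ induced by these. Then $C$ acts trivially on $T$: for every $c\in C$ and $\tau\in T$ (viewed in $N\le\mathrm{Perm}(G)$), $\lambda(c)\tau\lambda(c)^{ -1} = \tau$.
   Context: Hopf–Galois structures on a separable extension $M/F'$ with Galois closure group $\mathcal{G}$ and $\mathcal{G}_M = \mathrm{Gal}$ of closure over $M$ correspond (Greither–Pareigis) to regular subgroups of $\mathrm{Perm}(\mathcal{G}/\mathcal{G}_M)$ normalized by the image of the left translation map $\lambda$; this subgroup is the underlying group. Here $S\le\mathrm{Perm}(G/G_F)$ and $T\le\mathrm{Perm}(G_F)$. Every $g\in G$ is uniquely $g = xy$ with $x\in C$, $y\in G_F$, and $C\to G/G_F$, $x\mapsto xG_F$ is a bijection, identifying $\mathrm{Perm}(G/G_F)$ with $\mathrm{Perm}(C)$. The induced Hopf–Galois structure (Crespo–Rio–Vela) on $L/K$ has underlying group $N = \{\iota(\sigma,\tau)\}\le\mathrm{Perm}(G)$, where $\iota(\sigma,\tau)(xy) = \sigma(x)\tau(y)$ for $x\in C$, $y\in G_F$; $\tau\in T$ is identified with $\iota(1,\tau)$. $\lambda: G\to\mathrm{Perm}(G)$ is the left regular representation. -}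

module Defs where

open import Level using (Level; _⊔_; suc)
open import Algebra.Bundles using (Group)
open import Relation.Binary.Bundles using (Setoid)
open import Function.Bundles using (Inverse)
import Function.Construct.Identity as Id
import Function.Construct.Composition as Comp
import Function.Construct.Symmetry as Sym
open import Relation.Unary using (Pred; _∈_)
open import Data.Product using (Σ; Σ-syntax; ∃; _×_; _,_; proj₁; proj₂)
open import Data.Fin using (Fin)
import Relation.Binary.PropositionalEquality as ≡

private variable
  a b c ℓ p q : Level

Perm : Setoid a b → Set (a ⊔ b)
Perm X = Inverse X X

module _ (X : Setoid a b) where
  open Setoid X renaming (Carrier to A)

  _≐_ : Perm X → Perm X → Set (a ⊔ b)
  σ ≐ τ = ∀ x → Inverse.to σ x ≈ Inverse.to τ x

  record IsPermSubgroup (P : Pred (Perm X) q) : Set (a ⊔ b ⊔ q) where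
    field
      resp : ∀ {σ τ} → σ ≐ τ → P σ → P τ
      id∈  : P (Id.inverse X)
      ∘∈   : ∀ {σ τ} → P σ → P τ → P (Comp.inverse σ τ)
      inv∈ : ∀ {σ} → P σ → P (Sym.inverse σ)

  record IsRegular (P : Pred (Perm X) q) : Set (a ⊔ b ⊔ q) where
    field
      transitive : ∀ x y → Σ[ σ ∈ Perm X ] (P σ × Inverse.to σ x ≈ y)
      unique     : ∀ σ τ x → P σ → P τ →
                   Inverse.to σ x ≈ Inverse.to τ x → σ ≐ τ

  -- P is normalised by the image of an action  act : I → (A → A),
  -- where act (inv i) is the inverse of act i:
  -- for σ ∈ P and i ∈ I, act(i) ∘ σ ∘ act(i)⁻¹ ∈ P.
  Normalised : {I : Set c} → (act : I → A → A) → (inv : I → I) →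
               Pred (Perm X) q → Set (a ⊔ b ⊔ c ⊔ q)
  Normalised {I = I} act inv P =
    ∀ σ → P σ → ∀ (i : I) → Σ[ σ′ ∈ Perm X ]
      (P σ′ × (∀ x → Inverse.to σ′ x ≈ act i (Inverse.to σ (act (inv i) x))))

  -- Greither–Pareigis: underlying group of a Hopf–Galois structure is a
  -- regular subgroup of Perm(X) normalised by the image of λ.
  record IsHopfGaloisGroup {I : Set c} (act : I → A → A) (inv : I → I)
                           (P : Pred (Perm X) q) : Set (a ⊔ b ⊔ c ⊔ q) where
    field
      subgroup   : IsPermSubgroup P
      regular    : IsRegular P
      normalised : Normalised act inv P

module _ (G : Group c ℓ) where
  open Group G

  Finite : Set (c ⊔ ℓ)
  Finite = Σ[ n ∈ _ ] Inverse (≡.setoid (Fin n)) setoid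

  record IsSubgroup (H : Pred Carrier p) : Set (c ⊔ ℓ ⊔ p) where
    field
      resp : ∀ {x y} → x ≈ y → x ∈ H → y ∈ H
      ε∈   : ε ∈ H
      ∙∈   : ∀ {x y} → x ∈ H → y ∈ H → (x ∙ y) ∈ H
      ⁻¹∈  : ∀ {x} → x ∈ H → (x ⁻¹) ∈ H

  subSetoid : Pred Carrier p → Setoid (c ⊔ p) ℓ
  subSetoid H = record
    { Carrier = Σ Carrier (λ x → x ∈ H)
    ; _≈_ = λ u v → proj₁ u ≈ proj₁ v
    ; isEquivalence = record { refl = refl ; sym = sym ; trans = trans }
    }

  record IsNormalComplement (C H : Pred Carrier p) : Set (c ⊔ ℓ ⊔ p) where
    field
      subgroup : IsSubgroup C
      normal   : ∀ g x → x ∈ C → (g ∙ x ∙ g ⁻¹) ∈ C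
      decomp   : ∀ g → Σ[ x ∈ Σ Carrier (λ x → x ∈ C) ]
                       Σ[ y ∈ Σ Carrier (λ y → y ∈ H) ]
                         g ≈ proj₁ x ∙ proj₁ y
      unique   : ∀ x x′ y y′ → x ∈ C → x′ ∈ C → y ∈ H → y′ ∈ H →
                 x ∙ y ≈ x′ ∙ y′ → (x ≈ x′ × y ≈ y′)

  module Induced {C GF : Pred Carrier p} (GF-sub : IsSubgroup GF)
                 (nc : IsNormalComplement C GF) where
    open IsNormalComplement nc

    cpart : Carrier → Σ Carrier (λ x → x ∈ C)
    cpart g = proj₁ (decomp g)

    fpart : Carrier → Σ Carrier (λ y → y ∈ GF)
    fpart g = proj₁ (proj₂ (decomp g))

    -- λ(g) on G/G_F, transported to C via x ↦ x G_F :  x ↦ C-part of g x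
    λC : Carrier → Σ Carrier (λ x → x ∈ C) → Σ Carrier (λ x → x ∈ C)
    λC g x = cpart (g ∙ proj₁ x)

    λF : Σ Carrier (λ h → h ∈ GF) → Σ Carrier (λ y → y ∈ GF) →
         Σ Carrier (λ y → y ∈ GF)
    λF h y = (proj₁ h ∙ proj₁ y) , IsSubgroup.∙∈ GF-sub (proj₂ h) (proj₂ y)

    invF : Σ Carrier (λ h → h ∈ GF) → Σ Carrier (λ h → h ∈ GF)
    invF h = (proj₁ h ⁻¹) , IsSubgroup.⁻¹∈ GF-sub (proj₂ h)

    ι : Perm (subSetoid C) → Perm (subSetoid GF) → Carrier → Carrier
    ι σ τ g = proj₁ (Inverse.to σ (cpart g)) ∙ proj₁ (Inverse.to τ (fpart g))

    λG : Carrier → Carrier → Carrier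
    λG g h = g ∙ h

module Submission where

-- The argument is purely about the factorisation G = C·G_F and does not
-- use the Hopf–Galois hypotheses on S and T.  Write g = gᶜ gᶠ with gᶜ ∈ C,
-- gᶠ ∈ G_F.  For c ∈ C we have c g = (c gᶜ) gᶠ with c gᶜ ∈ C, so by
-- uniqueness of the factorisation left multiplication by c changes only
-- the C-part:  (c g)ᶜ = c gᶜ  and  (c g)ᶠ = gᶠ          (left-translate-by-C).
-- Consequently ι(1,τ)(c g) = c gᶜ τ(gᶠ) = c · ι(1,τ)(g): the map ι(1,τ)
-- commutes with left translation by elements of C      (ι-commutes-with-C).
-- The theorem is this commutation applied to c⁻¹ ∈ C, followed by the
-- group law c (c⁻¹ h) = h.

open import Defs
open import Level using (Level)
open import Algebra.Bundles using (Group)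
open import Relation.Unary using (Pred; _∈_)
open import Data.Product using (Σ; proj₁; proj₂; _,_; _×_)
open import Function.Bundles using (Inverse)
import Function.Construct.Identity as Id
import Algebra.Properties.Group as GroupProperties
import Relation.Binary.Reasoning.Setoid as SetoidReasoning

module LeftTranslationByComplement
    {c ℓ p : Level} (G : Group c ℓ) {GF C : Pred (Group.Carrier G) p}
    (GF-sub : IsSubgroup G GF) (nc : IsNormalComplement G C GF) where

  open Group G
  open SetoidReasoning setoid
  open IsNormalComplement nc
  open Induced G GF-sub nc

  _ᶜ : Carrier → Carrier
  g ᶜ = proj₁ (cpart g)

  _ᶠ : Carrier → Carrier
  g ᶠ = proj₁ (fpart g)

  factorisation : ∀ g → g ≈ g ᶜ ∙ g ᶠ
  factorisation g = proj₂ (proj₂ (decomp g))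

  left-translate-by-C : ∀ {x} → x ∈ C → ∀ g →
                        (x ∙ g) ᶜ ≈ x ∙ g ᶜ × (x ∙ g) ᶠ ≈ g ᶠ
  left-translate-by-C {x} x∈C g =
    unique _ _ _ _ (proj₂ (cpart (x ∙ g))) x∙gᶜ∈C
                   (proj₂ (fpart (x ∙ g))) (proj₂ (fpart g)) two-factorisations
    where
    x∙gᶜ∈C : (x ∙ g ᶜ) ∈ C
    x∙gᶜ∈C = IsSubgroup.∙∈ subgroup x∈C (proj₂ (cpart g))

    two-factorisations : (x ∙ g) ᶜ ∙ (x ∙ g) ᶠ ≈ (x ∙ g ᶜ) ∙ g ᶠ
    two-factorisations = begin
      (x ∙ g) ᶜ ∙ (x ∙ g) ᶠ  ≈⟨ factorisation (x ∙ g) ⟨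
      x ∙ g                  ≈⟨ ∙-congˡ (factorisation g) ⟩
      x ∙ (g ᶜ ∙ g ᶠ)        ≈⟨ assoc x (g ᶜ) (g ᶠ) ⟨
      (x ∙ g ᶜ) ∙ g ᶠ        ∎

  ι-commutes-with-C : ∀ (τ : Perm (subSetoid G GF)) {x} → x ∈ C → ∀ g →
                      ι (Id.inverse (subSetoid G C)) τ (x ∙ g)
                        ≈ x ∙ ι (Id.inverse (subSetoid G C)) τ g
  ι-commutes-with-C τ {x} x∈C g = begin
    (x ∙ g) ᶜ ∙ τ-of (fpart (x ∙ g))  ≈⟨ ∙-cong C-part (Inverse.to-cong τ GF-part) ⟩
    (x ∙ g ᶜ) ∙ τ-of (fpart g)        ≈⟨ assoc x (g ᶜ) (τ-of (fpart g)) ⟩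
    x ∙ (g ᶜ ∙ τ-of (fpart g))        ∎
    where
    τ-of : Σ Carrier (λ y → y ∈ GF) → Carrier
    τ-of y = proj₁ (Inverse.to τ y)

    C-part : (x ∙ g) ᶜ ≈ x ∙ g ᶜ
    C-part = proj₁ (left-translate-by-C x∈C g)

    GF-part : (x ∙ g) ᶠ ≈ g ᶠ
    GF-part = proj₂ (left-translate-by-C x∈C g)

proposition4p1 : ∀ {c ℓ p q r : Level} (G : Group c ℓ) → Finite G →
    (GF C : Pred (Group.Carrier G) p) →
    (GF-sub : IsSubgroup G GF) → (nc : IsNormalComplement G C GF) →
    (S : Pred (Perm (subSetoid G C)) q) →
    IsHopfGaloisGroup (subSetoid G C) (Induced.λC G GF-sub nc) (Group._⁻¹ G) S →
    (T : Pred (Perm (subSetoid G GF)) r) →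
    IsHopfGaloisGroup (subSetoid G GF) (Induced.λF G GF-sub nc) (Induced.invF G GF-sub nc) T →
    ∀ (x : Σ (Group.Carrier G) (λ x → x ∈ C)) (τ : Perm (subSetoid G GF)) → T τ →
    ∀ (g : Group.Carrier G) →
      Group._≈_ G
        (Induced.λG G GF-sub nc (proj₁ x)
          (Induced.ι G GF-sub nc (Id.inverse (subSetoid G C)) τ
            (Induced.λG G GF-sub nc (Group._⁻¹ G (proj₁ x)) g)))
        (Induced.ι G GF-sub nc (Id.inverse (subSetoid G C)) τ g)
proposition4p1 G _ GF C GF-sub nc _ _ _ _ (x , x∈C) τ _ g = begin
  x ∙ ι₁τ (x ⁻¹ ∙ g)    ≈⟨ ∙-congˡ (ι-commutes-with-C τ x⁻¹∈C g) ⟩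
  x ∙ (x ⁻¹ ∙ ι₁τ g)    ≈⟨ \\-leftDividesˡ x (ι₁τ g) ⟩
  ι₁τ g                 ∎
  where
  open Group G
  open SetoidReasoning setoid
  open GroupProperties G using (\\-leftDividesˡ)
  open LeftTranslationByComplement G GF-sub nc

  ι₁τ : Carrier → Carrier
  ι₁τ = Induced.ι G GF-sub nc (Id.inverse (subSetoid G C)) τ

  x⁻¹∈C : (x ⁻¹) ∈ C
  x⁻¹∈C = IsSubgroup.⁻¹∈ (IsNormalComplement.subgroup nc) x∈C
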